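{- Let $a,b\in\mathbb{Z}_{\geq2}$ and $c\in\mathbb{Z}_{\geq2}\cup\{\infty\}$ with $a\leq b\leq c$ and $\frac1a+\frac1b+\frac1c-1<0$, and let $k$ be an integer coprime to $2m$. Then $|ab-k_ab-k_ba|\geq1$.
   Context: $1/\infty=0$; $m=\operatorname{lcm}(\{a,b,c\}\setminus\{\infty\})$. For $s\in\{a,b\}$, $k_s$ is the unique integer with $0\leq k_s\leq s$ and $\cos(k_s\pi/s)=\cos(k\pi/s)$. -}

module Defs where

open import Data.Nat as ℕ using (ℕ; _≤_; _<_; _*_; _+_)
open import Data.Nat.LCM using (lcm)
open import Data.Integer as ℤ using (ℤ; +_)
open import Data.Integer.Divisibility as ℤD using ()
open import Data.Sum using (_⊎_)
open import Data.Product using (_×_)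

data ℕ∞ : Set where
  fin : ℕ → ℕ∞
  ∞   : ℕ∞

TwoLe : ℕ∞ → Set
TwoLe (fin c) = 2 ≤ c
TwoLe ∞       = Data.Unit.⊤ where import Data.Unit

Le∞ : ℕ → ℕ∞ → Set
Le∞ b (fin c) = b ≤ c
Le∞ b ∞       = Data.Unit.⊤ where import Data.Unit

-- 1/a + 1/b + 1/c - 1 < 0 (with 1/∞ = 0), multiplied out by abc (resp. ab)
Hyperbolic : ℕ → ℕ → ℕ∞ → Set
Hyperbolic a b (fin c) = b * c + a * c + a * b < a * b * c
Hyperbolic a b ∞       = b + a < a * b

mOf : ℕ → ℕ → ℕ∞ → ℕ
mOf a b (fin c) = lcm (lcm a b) c
mOf a b ∞       = lcm a b

-- j is k_s: 0 ≤ j ≤ s and cos(jπ/s) = cos(kπ/s), i.e. j ≡ ±k (mod 2s)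
IsKs : ℕ → ℤ → ℤ → Set
IsKs s k j = (+ 0 ℤ.≤ j) × (j ℤ.≤ + s) ×
             ((+ (2 * s) ℤD.∣ (j ℤ.- k)) ⊎ (+ (2 * s) ℤD.∣ (j ℤ.+ k)))

-- Write k_a = σ_a k + 2a x and k_b = σ_b k + 2b y with σ_a, σ_b = ±1. Then
-- ab - k_a b - k_b a = ab (1 - 2(x + y)) - k t with t = σ_a b + σ_b a. If this
-- vanished, ab would divide k t, hence t since gcd(k, ab) = 1; but |t| ≤ a + b < ab
-- forces t = 0, and then ab times the odd number 1 - 2(x + y) would be 0.

module Submission where

open import Defs
open import Data.Nat as ℕ using (ℕ; _≤_; _*_)
open import Data.Nat.Coprimality using (Coprime; coprime-divisor) renaming (sym to coprime-sym)
open import Data.Integer as ℤ using (ℤ; +_)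

import Data.Nat.Properties as ℕP
import Data.Integer.Properties as ℤP
open import Data.Nat.Divisibility as ℕD using (divides; ∣-trans)
import Data.Integer.Divisibility as ℤD
import Data.Integer.Divisibility.Signed as ℤS
open import Data.Nat.LCM using (lcm; m∣lcm[m,n]; n∣lcm[m,n])
open import Data.Integer.Tactic.RingSolver using (solve-∀)
open import Data.Product using (Σ-syntax; _×_; _,_)
open import Data.Sum using (inj₁; inj₂)
open import Relation.Binary.PropositionalEquality
open import Relation.Nullary using (contradiction)

private
  variable
    d m n o : ℕ

coprime-∣ˡ : Coprime m o → d ℕD.∣ m → Coprime d o
coprime-∣ˡ m⊥o d∣m (e∣d , e∣o) = m⊥o (∣-trans e∣d d∣m , e∣o)

coprime-*ˡ : Coprime m o → Coprime n o → Coprime (m * n) o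
coprime-*ˡ m⊥o n⊥o (d∣mn , d∣o) = n⊥o (coprime-divisor d⊥m d∣mn , d∣o)
  where
  d⊥m : Coprime _ _
  d⊥m (e∣d , e∣m) = m⊥o (e∣m , ∣-trans e∣d d∣o)

∣∧<⇒≡0 : m ℕD.∣ n → n ℕ.< m → n ≡ 0
∣∧<⇒≡0 {n = ℕ.zero}  _   _   = refl
∣∧<⇒≡0 {n = ℕ.suc _} m∣n n<m = contradiction m∣n (ℕD.>⇒∤ n<m)

∣σ*n∣≡n : ∀ σ n → ℤ.∣ σ ∣ ≡ 1 → ℤ.∣ σ ℤ.* + n ∣ ≡ n
∣σ*n∣≡n σ n ∣σ∣≡1 = begin
  ℤ.∣ σ ℤ.* + n ∣ ≡⟨ ℤP.abs-* σ (+ n) ⟩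
  ℤ.∣ σ ∣ * n     ≡⟨ cong (_* n) ∣σ∣≡1 ⟩
  1 * n           ≡⟨ ℕP.*-identityˡ n ⟩
  n               ∎
  where open ≡-Reasoning

1-2*i≢0 : ∀ i → + 1 ℤ.- + 2 ℤ.* i ≢ + 0
1-2*i≢0 i 1-2i≡0 = contradiction (ℕD.∣1⇒≡1 2∣1) λ ()
  where
  1≡i*2 : + 1 ≡ i ℤ.* + 2
  1≡i*2 = trans (ℤP.i-j≡0⇒i≡j _ _ 1-2i≡0) (ℤP.*-comm (+ 2) i)
  2∣1 : 2 ℕD.∣ 1
  2∣1 = ℤS.∣⇒∣ᵤ (ℤS.divides i 1≡i*2)

n*odd≢k*t : ∀ {n k t} → Coprime n ℤ.∣ k ∣ → ℤ.∣ t ∣ ℕ.< n →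
            ∀ w → + n ℤ.* (+ 1 ℤ.- + 2 ℤ.* w) ≢ k ℤ.* t
n*odd≢k*t {n} {k} {t} n⊥k ∣t∣<n w eq = 1-2*i≢0 w (ℤP.∣i∣≡0⇒i≡0 ∣z∣≡0)
  where
  z : ℤ
  z = + 1 ℤ.- + 2 ℤ.* w
  ∣eq∣ : n * ℤ.∣ z ∣ ≡ ℤ.∣ k ∣ * ℤ.∣ t ∣
  ∣eq∣ = trans (sym (ℤP.abs-* (+ n) z)) (trans (cong ℤ.∣_∣ eq) (ℤP.abs-* k t))
  ∣t∣≡0 : ℤ.∣ t ∣ ≡ 0
  ∣t∣≡0 = ∣∧<⇒≡0 (coprime-divisor n⊥k (divides ℤ.∣ z ∣ (trans (sym ∣eq∣) (ℕP.*-comm n _)))) ∣t∣<n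
  n*∣z∣≡0 : n * ℤ.∣ z ∣ ≡ 0
  n*∣z∣≡0 = trans ∣eq∣ (trans (cong (ℤ.∣ k ∣ *_) ∣t∣≡0) (ℕP.*-zeroʳ ℤ.∣ k ∣))
  ∣z∣≡0 : ℤ.∣ z ∣ ≡ 0
  ∣z∣≡0 with ℕP.m*n≡0⇒m≡0∨n≡0 n n*∣z∣≡0
  ... | inj₁ refl   = contradiction ∣t∣<n ℕP.n≮0
  ... | inj₂ ∣z∣≡0 = ∣z∣≡0

+[m*n]∣⇒≡*[+m*+n] : ∀ m n {i} → + (m * n) ℤD.∣ i → Σ[ x ∈ ℤ ] i ≡ x ℤ.* (+ m ℤ.* + n)
+[m*n]∣⇒≡*[+m*+n] m n m*n∣i with ℤS.∣ᵤ⇒∣ m*n∣i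
... | ℤS.divides x i≡x*mn = x , trans i≡x*mn (cong (x ℤ.*_) (ℤP.pos-* m n))

IsKs⇒≡σ*k+x*2s : ∀ {s k j} → IsKs s k j →
               Σ[ σ ∈ ℤ ] Σ[ x ∈ ℤ ] ℤ.∣ σ ∣ ≡ 1 × j ≡ σ ℤ.* k ℤ.+ x ℤ.* (+ 2 ℤ.* + s)
IsKs⇒≡σ*k+x*2s {s} {k} {j} (_ , _ , inj₁ 2s∣j-k) with +[m*n]∣⇒≡*[+m*+n] 2 s 2s∣j-k
... | x , j-k≡x*2s = ℤ.1ℤ , x , refl , trans (j≡k+[j-k] j k) (cong (λ r → ℤ.1ℤ ℤ.* k ℤ.+ r) j-k≡x*2s)
  where
  j≡k+[j-k] : ∀ j k → j ≡ ℤ.1ℤ ℤ.* k ℤ.+ (j ℤ.- k)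
  j≡k+[j-k] = solve-∀
IsKs⇒≡σ*k+x*2s {s} {k} {j} (_ , _ , inj₂ 2s∣j+k) with +[m*n]∣⇒≡*[+m*+n] 2 s 2s∣j+k
... | x , j+k≡x*2s = ℤ.-1ℤ , x , refl , trans (j≡-k+[j+k] j k) (cong (λ r → ℤ.-1ℤ ℤ.* k ℤ.+ r) j+k≡x*2s)
  where
  j≡-k+[j+k] : ∀ j k → j ≡ ℤ.-1ℤ ℤ.* k ℤ.+ (j ℤ.+ k)
  j≡-k+[j+k] = solve-∀

E≡ab*odd-k*t : ∀ a b k σa σb x y →
  + (a * b) ℤ.- (σa ℤ.* k ℤ.+ x ℤ.* (+ 2 ℤ.* + a)) ℤ.* + b ℤ.- (σb ℤ.* k ℤ.+ y ℤ.* (+ 2 ℤ.* + b)) ℤ.* + a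
    ≡ + (a * b) ℤ.* (+ 1 ℤ.- + 2 ℤ.* (x ℤ.+ y)) ℤ.- k ℤ.* (σa ℤ.* + b ℤ.+ σb ℤ.* + a)
E≡ab*odd-k*t a b k σa σb x y = begin
  + (a * b) ℤ.- ka ℤ.* + b ℤ.- kb ℤ.* + a   ≡⟨ cong (λ ab → ab ℤ.- ka ℤ.* + b ℤ.- kb ℤ.* + a) (ℤP.pos-* a b) ⟩
  + a ℤ.* + b ℤ.- ka ℤ.* + b ℤ.- kb ℤ.* + a ≡⟨ expand (+ a) (+ b) k σa σb x y ⟩
  + a ℤ.* + b ℤ.* z ℤ.- k ℤ.* t             ≡⟨ cong (λ ab → ab ℤ.* z ℤ.- k ℤ.* t) (ℤP.pos-* a b) ⟨
  + (a * b) ℤ.* z ℤ.- k ℤ.* t               ∎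
  where
  open ≡-Reasoning
  ka kb z t : ℤ
  ka = σa ℤ.* k ℤ.+ x ℤ.* (+ 2 ℤ.* + a)
  kb = σb ℤ.* k ℤ.+ y ℤ.* (+ 2 ℤ.* + b)
  z = + 1 ℤ.- + 2 ℤ.* (x ℤ.+ y)
  t = σa ℤ.* + b ℤ.+ σb ℤ.* + a
  expand : ∀ A B k σa σb x y →
    A ℤ.* B ℤ.- (σa ℤ.* k ℤ.+ x ℤ.* (+ 2 ℤ.* A)) ℤ.* B ℤ.- (σb ℤ.* k ℤ.+ y ℤ.* (+ 2 ℤ.* B)) ℤ.* A
      ≡ A ℤ.* B ℤ.* (+ 1 ℤ.- + 2 ℤ.* (x ℤ.+ y)) ℤ.- k ℤ.* (σa ℤ.* B ℤ.+ σb ℤ.* A)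
  expand = solve-∀

Hyperbolic⇒b+a<a*b : ∀ a b c → Hyperbolic a b c → b ℕ.+ a ℕ.< a * b
Hyperbolic⇒b+a<a*b a b ∞       h = h
Hyperbolic⇒b+a<a*b a b (fin c) h = ℕP.*-cancelʳ-< c (b ℕ.+ a) (a * b) (begin-strict
  (b ℕ.+ a) * c              ≡⟨ ℕP.*-distribʳ-+ c b a ⟩
  b * c ℕ.+ a * c            ≤⟨ ℕP.m≤m+n _ (a * b) ⟩
  b * c ℕ.+ a * c ℕ.+ a * b  <⟨ h ⟩
  a * b * c                  ∎)
  where open ℕP.≤-Reasoning

a∣mOf : ∀ a b c → a ℕD.∣ mOf a b c
a∣mOf a b (fin c) = ∣-trans (m∣lcm[m,n] a b) (m∣lcm[m,n] (lcm a b) c)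
a∣mOf a b ∞       = m∣lcm[m,n] a b

b∣mOf : ∀ a b c → b ℕD.∣ mOf a b c
b∣mOf a b (fin c) = ∣-trans (n∣lcm[m,n] a b) (m∣lcm[m,n] (lcm a b) c)
b∣mOf a b ∞       = n∣lcm[m,n] a b

-- Only a + b < ab and gcd(k, ab) = 1 are needed.
lemma3p6 : (a b : ℕ) (c : ℕ∞) → 2 ≤ a → 2 ≤ b → TwoLe c → a ≤ b → Le∞ b c →
           Hyperbolic a b c → (k : ℤ) → Coprime ℤ.∣ k ∣ (2 * mOf a b c) →
           (ka kb : ℤ) → IsKs a k ka → IsKs b k kb →
           1 ≤ ℤ.∣ (+ (a * b)) ℤ.- ka ℤ.* (+ b) ℤ.- kb ℤ.* (+ a) ∣
lemma3p6 a b c _ _ _ _ _ hyp k k⊥2m ka kb ka-isKs kb-isKs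
  with IsKs⇒≡σ*k+x*2s ka-isKs | IsKs⇒≡σ*k+x*2s kb-isKs
... | σa , x , ∣σa∣≡1 , refl | σb , y , ∣σb∣≡1 , refl = ℕP.n≢0⇒n>0 λ ∣E∣≡0 →
  n*odd≢k*t {k = k} {t = t} ab⊥k ∣t∣<ab (x ℤ.+ y)
    (ℤP.i-j≡0⇒i≡j _ _ (trans (sym (E≡ab*odd-k*t a b k σa σb x y)) (ℤP.∣i∣≡0⇒i≡0 ∣E∣≡0)))
  where
  m⊥k : Coprime (mOf a b c) ℤ.∣ k ∣
  m⊥k = coprime-∣ˡ (coprime-sym k⊥2m) (ℕD.n∣m*n 2)
  ab⊥k : Coprime (a * b) ℤ.∣ k ∣
  ab⊥k = coprime-*ˡ (coprime-∣ˡ m⊥k (a∣mOf a b c)) (coprime-∣ˡ m⊥k (b∣mOf a b c))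
  t : ℤ
  t = σa ℤ.* + b ℤ.+ σb ℤ.* + a
  ∣t∣<ab : ℤ.∣ t ∣ ℕ.< a * b
  ∣t∣<ab = begin-strict
    ℤ.∣ t ∣                               ≤⟨ ℤP.∣i+j∣≤∣i∣+∣j∣ (σa ℤ.* + b) (σb ℤ.* + a) ⟩
    ℤ.∣ σa ℤ.* + b ∣ ℕ.+ ℤ.∣ σb ℤ.* + a ∣ ≡⟨ cong₂ ℕ._+_ (∣σ*n∣≡n σa b ∣σa∣≡1) (∣σ*n∣≡n σb a ∣σb∣≡1) ⟩
    b ℕ.+ a                               <⟨ Hyperbolic⇒b+a<a*b a b c hyp ⟩
    a * b                                 ∎
    where open ℕP.≤-Reasoning
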